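{- For every integer $k$ with $1\leq k\leq 29$ and $\gcd(k,30)=1$, and for every positive integer $K$, $$\sum_{n=1}^{K}\sigma(30n)>\sum_{n=1}^{K}\sigma(30n+k).$$
   Context: For a positive integer $n$, $\sigma(n)$ denotes the sum of all positive divisors of $n$. -}

module Defs where

open import Data.Nat using (ℕ; zero; suc; _+_; _*_)
open import Data.Nat.Divisibility using (_∣?_)
open import Data.List using (List; filter)
open import Data.Nat.ListAction using (sum)
open import Data.List using (upTo)

range1 : ℕ → List ℕ
range1 n = Data.List.map suc (upTo n)

-- σ n = sum of positive divisors of n (for n ≥ 1); divisors of n lie in 1..n
σ : ℕ → ℕ
σ n = sum (filter (_∣? n) (range1 n))

sumFrom1 : ℕ → (ℕ → ℕ) → ℕ
sumFrom1 zero    f = 0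
sumFrom1 (suc K) f = sumFrom1 K f + f (suc K)

-- Writing σ m as the sum of the cofactors v over the factorisations e * v = m and exchanging sums,
-- each side becomes a sum over e of the cofactors v for which e * v lies in the progression.
-- For 30 n + k only e coprime to 30 contribute; their cofactors are then pairwise congruent
-- mod 30 and below 30 (⌊K/e⌋ + 1), so they add up to at most Σ_{j ≤ ⌊K/e⌋} 30 j + 29 (⌊K/e⌋ + 1).
-- For 30 n the cofactors 30 j with j ≤ ⌊K/e⌋ already give Σ_{j ≤ ⌊K/e⌋} 30 j, and every divisor
-- e ≥ 2 of 30 adds (30/e)(1 + ⋯ + K). These extra terms total 42 K (K + 1) / 2, which beats
-- 29 Σ_{e coprime to 30} (⌊K/e⌋ + 1) as soon as K ≥ 25; smaller K are checked by computation.

module Submission where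

open import Defs
open import Data.Bool using (Bool; true; T; _∧_)
open import Data.Bool.Properties using (T-∧)
open import Data.Empty using (⊥-elim)
open import Data.List using ([_]; _++_; filter; map; upTo)
open import Data.List.Membership.Propositional.Properties using (∈-upTo⁺)
open import Data.List.Properties using (upTo-∷ʳ; map-++; filter-++)
open import Data.List.Relation.Unary.All as All using (All)
open import Data.Nat
open import Data.Nat.Coprimality using (gcd≡1⇒coprime; coprime-divisor)
import Data.Nat.Coprimality as Coprimality
open import Data.Nat.Divisibility
open import Data.Nat.DivMod
open import Data.Nat.GCD
open import Data.Nat.ListAction using (sum)
open import Data.Nat.ListAction.Properties using (sum-++)
open import Data.Nat.Properties
open import Algebra.Properties.CommutativeSemigroup +-commutativeSemigroup using (interchange)
open import Algebra.Properties.CommutativeSemigroup *-commutativeSemigroup using (x∙yz≈y∙xz; x∙yz≈yx∙z)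
open import Data.Nat.Tactic.RingSolver using (solve-∀)
open import Data.Product using (_×_; _,_; proj₁; proj₂; ∃-syntax)
open import Data.Sum using (_⊎_; inj₁; inj₂)
open import Function using (_∘_)
open import Function.Bundles using (Equivalence)
open import Level using (0ℓ)
open import Relation.Nullary using (Dec; yes; no; ¬_)
open import Relation.Nullary.Decidable using (T?; _→-dec_; toWitness)
open import Relation.Unary using (Pred; Decidable)
open import Relation.Binary.PropositionalEquality
  using (_≡_; _≢_; refl; sym; trans; cong; cong₂; subst; module ≡-Reasoning)

∑-syntax : ℕ → (ℕ → ℕ) → ℕ
∑-syntax = sumFrom1

infix 9 ∑-syntax
syntax ∑-syntax N (λ i → t) = ∑[ i ≤ N ] t

𝟙 : ∀ {p} {P : Set p} → Dec P → ℕ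
𝟙 (yes _) = 1
𝟙 (no _)  = 0

𝟙≤1 : ∀ {p} {P : Set p} (d : Dec P) → 𝟙 d ≤ 1
𝟙≤1 (yes _) = s≤s z≤n
𝟙≤1 (no _)  = z≤n

module _ {f g : ℕ → ℕ} where

  ∑-cong : ∀ N → (∀ i → 1 ≤ i → i ≤ N → f i ≡ g i) → ∑[ i ≤ N ] f i ≡ ∑[ i ≤ N ] g i
  ∑-cong zero    eq = refl
  ∑-cong (suc N) eq =
    cong₂ _+_ (∑-cong N (λ i 1≤i i≤N → eq i 1≤i (m≤n⇒m≤1+n i≤N))) (eq (suc N) (s≤s z≤n) ≤-refl)

  ∑-mono-≤ : ∀ N → (∀ i → 1 ≤ i → i ≤ N → f i ≤ g i) → ∑[ i ≤ N ] f i ≤ ∑[ i ≤ N ] g i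
  ∑-mono-≤ zero    le = z≤n
  ∑-mono-≤ (suc N) le =
    +-mono-≤ (∑-mono-≤ N (λ i 1≤i i≤N → le i 1≤i (m≤n⇒m≤1+n i≤N))) (le (suc N) (s≤s z≤n) ≤-refl)

∑-zero : ∀ N → ∑[ i ≤ N ] 0 ≡ 0
∑-zero zero    = refl
∑-zero (suc N) = cong (_+ 0) (∑-zero N)

∑-vanish : ∀ N {f : ℕ → ℕ} → (∀ i → 1 ≤ i → i ≤ N → f i ≡ 0) → ∑[ i ≤ N ] f i ≡ 0
∑-vanish N eq = trans (∑-cong N eq) (∑-zero N)

∑-distrib-+ : ∀ N (f g : ℕ → ℕ) → ∑[ i ≤ N ] (f i + g i) ≡ ∑[ i ≤ N ] f i + ∑[ i ≤ N ] g i
∑-distrib-+ zero    f g = refl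
∑-distrib-+ (suc N) f g = begin
  ∑[ i ≤ N ] (f i + g i) + (f (suc N) + g (suc N))
    ≡⟨ cong (_+ (f (suc N) + g (suc N))) (∑-distrib-+ N f g) ⟩
  ∑[ i ≤ N ] f i + ∑[ i ≤ N ] g i + (f (suc N) + g (suc N))
    ≡⟨ interchange (∑[ i ≤ N ] f i) _ _ _ ⟩
  ∑[ i ≤ N ] f i + f (suc N) + (∑[ i ≤ N ] g i + g (suc N)) ∎
  where open ≡-Reasoning

∑-*ˡ : ∀ N c (f : ℕ → ℕ) → ∑[ i ≤ N ] (c * f i) ≡ c * ∑[ i ≤ N ] f i
∑-*ˡ zero    c f = sym (*-zeroʳ c)
∑-*ˡ (suc N) c f = trans (cong (_+ c * f (suc N)) (∑-*ˡ N c f)) (sym (*-distribˡ-+ c _ _))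

∑-*ʳ : ∀ N c (f : ℕ → ℕ) → ∑[ i ≤ N ] (f i * c) ≡ ∑[ i ≤ N ] f i * c
∑-*ʳ N c f = begin
  ∑[ i ≤ N ] (f i * c) ≡⟨ ∑-cong N (λ i _ _ → *-comm (f i) c) ⟩
  ∑[ i ≤ N ] (c * f i) ≡⟨ ∑-*ˡ N c f ⟩
  c * ∑[ i ≤ N ] f i   ≡⟨ *-comm c _ ⟩
  ∑[ i ≤ N ] f i * c   ∎
  where open ≡-Reasoning

∑-comm : ∀ N M (f : ℕ → ℕ → ℕ) → ∑[ i ≤ N ] ∑[ j ≤ M ] f i j ≡ ∑[ j ≤ M ] ∑[ i ≤ N ] f i j
∑-comm zero    M f = sym (∑-zero M)
∑-comm (suc N) M f = begin
  ∑[ i ≤ N ] ∑[ j ≤ M ] f i j + ∑[ j ≤ M ] f (suc N) j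
    ≡⟨ cong (_+ ∑[ j ≤ M ] f (suc N) j) (∑-comm N M f) ⟩
  ∑[ j ≤ M ] ∑[ i ≤ N ] f i j + ∑[ j ≤ M ] f (suc N) j
    ≡⟨ ∑-distrib-+ M (λ j → ∑[ i ≤ N ] f i j) (f (suc N)) ⟨
  ∑[ j ≤ M ] (∑[ i ≤ N ] f i j + f (suc N) j) ∎
  where open ≡-Reasoning

∑-+ : ∀ a b (f : ℕ → ℕ) → ∑[ i ≤ a + b ] f i ≡ ∑[ i ≤ a ] f i + ∑[ i ≤ b ] f (a + i)
∑-+ a zero    f = trans (cong (λ n → ∑[ i ≤ n ] f i) (+-identityʳ a)) (sym (+-identityʳ _))
∑-+ a (suc b) f rewrite +-suc a b | ∑-+ a b f = +-assoc (∑[ i ≤ a ] f i) _ _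

∑-mono-range : ∀ {M N} (f : ℕ → ℕ) → M ≤ N → ∑[ i ≤ M ] f i ≤ ∑[ i ≤ N ] f i
∑-mono-range {M} {N} f M≤N = begin
  ∑[ i ≤ M ] f i                                   ≤⟨ m≤m+n _ _ ⟩
  ∑[ i ≤ M ] f i + ∑[ i ≤ N ∸ M ] f (M + i)        ≡⟨ ∑-+ M (N ∸ M) f ⟨
  ∑[ i ≤ M + (N ∸ M) ] f i                         ≡⟨ cong (λ n → ∑[ i ≤ n ] f i) (m+[n∸m]≡n M≤N) ⟩
  ∑[ i ≤ N ] f i                                   ∎
  where open ≤-Reasoning

term≤∑ : ∀ {i N} (f : ℕ → ℕ) → 1 ≤ i → i ≤ N → f i ≤ ∑[ j ≤ N ] f j
term≤∑ {suc i} f _ i<N = ≤-trans (m≤n+m (f (suc i)) _) (∑-mono-range f i<N)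

∑-support : ∀ M N (f : ℕ → ℕ) → (∀ i → M < i → f i ≡ 0) → ∑[ i ≤ N ] f i ≤ ∑[ i ≤ M ] f i
∑-support M zero    f vanish = z≤n
∑-support M (suc N) f vanish with suc N ≤? M
... | yes N<M = ∑-mono-range f N<M
... | no  N≮M = begin
  ∑[ i ≤ N ] f i + f (suc N) ≡⟨ cong (∑[ i ≤ N ] f i +_) (vanish (suc N) (≰⇒> N≮M)) ⟩
  ∑[ i ≤ N ] f i + 0         ≡⟨ +-identityʳ _ ⟩
  ∑[ i ≤ N ] f i             ≤⟨ ∑-support M N f vanish ⟩
  ∑[ i ≤ M ] f i             ∎
  where open ≤-Reasoning

∑-dilate : ∀ s J (f : ℕ → ℕ) → 1 ≤ s → ∑[ j ≤ J ] f (s * j) ≤ ∑[ i ≤ s * J ] f i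
∑-dilate s zero    f _   = z≤n
∑-dilate s (suc J) f 1≤s = begin
  ∑[ j ≤ J ] f (s * j) + f (s * suc J)         ≤⟨ +-monoˡ-≤ _ (∑-dilate s J f 1≤s) ⟩
  ∑[ i ≤ s * J ] f i + f (s * suc J)           ≡⟨ cong (λ n → ∑[ i ≤ s * J ] f i + f n) s[1+J]≡sJ+s ⟩
  ∑[ i ≤ s * J ] f i + f (s * J + s)           ≤⟨ +-monoʳ-≤ _ (term≤∑ (λ i → f (s * J + i)) 1≤s ≤-refl) ⟩
  ∑[ i ≤ s * J ] f i + ∑[ i ≤ s ] f (s * J + i) ≡⟨ ∑-+ (s * J) s f ⟨
  ∑[ i ≤ s * J + s ] f i                       ≡⟨ cong (λ n → ∑[ i ≤ n ] f i) s[1+J]≡sJ+s ⟨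
  ∑[ i ≤ s * suc J ] f i                       ∎
  where
  open ≤-Reasoning
  s[1+J]≡sJ+s : s * suc J ≡ s * J + s
  s[1+J]≡sJ+s = trans (*-suc s J) (+-comm s (s * J))

2*∑id≡K*[1+K] : ∀ K → 2 * ∑[ j ≤ K ] j ≡ K * suc K
2*∑id≡K*[1+K] zero    = refl
2*∑id≡K*[1+K] (suc K) = begin
  2 * (∑[ j ≤ K ] j + suc K)     ≡⟨ *-distribˡ-+ 2 (∑[ j ≤ K ] j) (suc K) ⟩
  2 * ∑[ j ≤ K ] j + 2 * suc K   ≡⟨ cong (_+ 2 * suc K) (2*∑id≡K*[1+K] K) ⟩
  K * suc K + 2 * suc K          ≡⟨ expand K ⟩
  suc K * suc (suc K)            ∎
  where
  open ≡-Reasoning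
  expand : ∀ K → K * suc K + 2 * suc K ≡ suc K * suc (suc K)
  expand = solve-∀

module _ {P : ℕ → Set} (P? : ∀ i → Dec (P i)) where

  ∑𝟙-none : ∀ N → (∀ i → 1 ≤ i → i ≤ N → ¬ P i) → ∑[ i ≤ N ] 𝟙 (P? i) ≡ 0
  ∑𝟙-none N ¬P = ∑-vanish N 𝟙≡0
    where
    𝟙≡0 : ∀ i → 1 ≤ i → i ≤ N → 𝟙 (P? i) ≡ 0
    𝟙≡0 i 1≤i i≤N with P? i
    ... | yes p = ⊥-elim (¬P i 1≤i i≤N p)
    ... | no  _ = refl

  ∑𝟙-witness : ∀ N i → 1 ≤ i → i ≤ N → P i → 1 ≤ ∑[ j ≤ N ] 𝟙 (P? j)
  ∑𝟙-witness N i 1≤i i≤N p = ≤-trans (𝟙≥1 (P? i)) (term≤∑ (λ j → 𝟙 (P? j)) 1≤i i≤N)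
    where
    𝟙≥1 : (d : Dec (P i)) → 1 ≤ 𝟙 d
    𝟙≥1 (yes _) = ≤-refl
    𝟙≥1 (no ¬p) = ⊥-elim (¬p p)

  ∑𝟙-unique : ∀ N → (∀ i j → 1 ≤ i → i ≤ N → 1 ≤ j → j ≤ N → P i → P j → i ≡ j) →
              ∑[ i ≤ N ] 𝟙 (P? i) ≤ 1
  ∑𝟙-unique zero    unique = z≤n
  ∑𝟙-unique (suc N) unique with P? (suc N)
  ... | no _ = ≤-trans (≤-reflexive (+-identityʳ _))
                 (∑𝟙-unique N (λ i j 1≤i i≤N 1≤j j≤N → unique i j 1≤i (m≤n⇒m≤1+n i≤N) 1≤j (m≤n⇒m≤1+n j≤N)))
  ... | yes p = ≤-reflexive (cong (_+ 1) (∑𝟙-none N ¬P))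
    where
    ¬P : ∀ i → 1 ≤ i → i ≤ N → ¬ P i
    ¬P i 1≤i i≤N q = <⇒≢ (s≤s i≤N) (unique i (suc N) 1≤i (m≤n⇒m≤1+n i≤N) (s≤s z≤n) ≤-refl q p)

-- σ as a sum over cofactors

sum-filter-range1 : ∀ {P : Pred ℕ 0ℓ} (P? : Decidable P) n →
                    sum (filter P? (range1 n)) ≡ ∑[ i ≤ n ] (𝟙 (P? i) * i)
sum-filter-range1 P? zero    = refl
sum-filter-range1 P? (suc n) = begin
  sum (filter P? (map suc (upTo (suc n))))          ≡⟨ cong (sum ∘ filter P? ∘ map suc) (upTo-∷ʳ n) ⟨
  sum (filter P? (map suc (upTo n ++ [ n ]))) ≡⟨ cong (sum ∘ filter P?) (map-++ suc (upTo n) [ n ]) ⟩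
  sum (filter P? (range1 n ++ [ suc n ])) ≡⟨ cong sum (filter-++ P? (range1 n) [ suc n ]) ⟩
  sum (filter P? (range1 n) ++ filter P? [ suc n ]) ≡⟨ sum-++ (filter P? (range1 n)) _ ⟩
  sum (filter P? (range1 n)) + sum (filter P? [ suc n ])
    ≡⟨ cong₂ _+_ (sum-filter-range1 P? n) (sum-filter-singleton (suc n)) ⟩
  ∑[ i ≤ n ] (𝟙 (P? i) * i) + 𝟙 (P? (suc n)) * suc n ∎
  where
  open ≡-Reasoning
  sum-filter-singleton : ∀ x → sum (filter P? [ x ]) ≡ 𝟙 (P? x) * x
  sum-filter-singleton x with P? x
  ... | yes _ = refl
  ... | no  _ = refl

𝟙∣≡∑𝟙-cofactor : ∀ N m v → 1 ≤ v → 1 ≤ m → m ≤ N → 𝟙 (v ∣? m) ≡ ∑[ e ≤ N ] 𝟙 (e * v ≟ m)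
𝟙∣≡∑𝟙-cofactor N m v 1≤v 1≤m m≤N with v ∣? m
... | no  v∤m = sym (∑𝟙-none (λ e → e * v ≟ m) N (λ e _ _ ev≡m → v∤m (divides e (sym ev≡m))))
... | yes (divides q m≡qv) = ≤-antisym
  (∑𝟙-witness (λ e → e * v ≟ m) N q 1≤q q≤N (sym m≡qv))
  (∑𝟙-unique (λ e → e * v ≟ m) N (λ i j _ _ _ _ iv≡m jv≡m →
    *-cancelʳ-≡ i j v {{>-nonZero 1≤v}} (trans iv≡m (sym jv≡m))))
  where
  1≤q : 1 ≤ q
  1≤q = n≢0⇒n>0 (λ { refl → <⇒≢ 1≤m (sym m≡qv) })
  q≤N : q ≤ N
  q≤N = ≤-trans (m≤m*n q v {{>-nonZero 1≤v}}) (≤-trans (≤-reflexive (sym m≡qv)) m≤N)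

σ≡∑∑ : ∀ N m → 1 ≤ m → m ≤ N → σ m ≡ ∑[ v ≤ N ] ∑[ e ≤ N ] (𝟙 (e * v ≟ m) * v)
σ≡∑∑ N m 1≤m m≤N = begin
  σ m                                      ≡⟨ sum-filter-range1 (_∣? m) m ⟩
  ∑[ v ≤ m ] (𝟙 (v ∣? m) * v)              ≡⟨ ≤-antisym (∑-mono-range divisorTerm m≤N)
                                                         (∑-support m N divisorTerm beyond-m) ⟩
  ∑[ v ≤ N ] (𝟙 (v ∣? m) * v)              ≡⟨ ∑-cong N (λ v 1≤v _ →
                                                cong (_* v) (𝟙∣≡∑𝟙-cofactor N m v 1≤v 1≤m m≤N)) ⟩
  ∑[ v ≤ N ] (∑[ e ≤ N ] 𝟙 (e * v ≟ m) * v) ≡⟨ ∑-cong N (λ v _ _ → ∑-*ʳ N v (λ e → 𝟙 (e * v ≟ m))) ⟨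
  ∑[ v ≤ N ] ∑[ e ≤ N ] (𝟙 (e * v ≟ m) * v) ∎
  where
  open ≡-Reasoning
  divisorTerm : ℕ → ℕ
  divisorTerm v = 𝟙 (v ∣? m) * v
  beyond-m : ∀ v → m < v → divisorTerm v ≡ 0
  beyond-m v m<v with v ∣? m
  ... | yes v∣m = ⊥-elim (<⇒≱ m<v (∣⇒≤ {{>-nonZero 1≤m}} v∣m))
  ... | no  _   = refl

hits : ℕ → (ℕ → ℕ) → ℕ → ℕ
hits K f x = ∑[ n ≤ K ] 𝟙 (x ≟ f n)

-- The sum of f n / e over the n ≤ K with e ∣ f n, as long as every f n is at most N.
cofactorSum : ℕ → ℕ → (ℕ → ℕ) → ℕ → ℕ
cofactorSum N K f e = ∑[ v ≤ N ] (hits K f (e * v) * v)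

∑σ≡∑cofactorSum : ∀ K N (f : ℕ → ℕ) → (∀ n → 1 ≤ n → n ≤ K → 1 ≤ f n × f n ≤ N) →
                  ∑[ n ≤ K ] σ (f n) ≡ ∑[ e ≤ N ] cofactorSum N K f e
∑σ≡∑cofactorSum K N f f∈[1,N] = begin
  ∑[ n ≤ K ] σ (f n)
    ≡⟨ ∑-cong K (λ n 1≤n n≤K → σ≡∑∑ N (f n) (proj₁ (f∈[1,N] n 1≤n n≤K)) (proj₂ (f∈[1,N] n 1≤n n≤K))) ⟩
  ∑[ n ≤ K ] ∑[ v ≤ N ] ∑[ e ≤ N ] term n v e
    ≡⟨ ∑-comm K N (λ n v → ∑[ e ≤ N ] term n v e) ⟩
  ∑[ v ≤ N ] ∑[ n ≤ K ] ∑[ e ≤ N ] term n v e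
    ≡⟨ ∑-cong N (λ v _ _ → ∑-comm K N (λ n e → term n v e)) ⟩
  ∑[ v ≤ N ] ∑[ e ≤ N ] ∑[ n ≤ K ] term n v e
    ≡⟨ ∑-comm N N (λ v e → ∑[ n ≤ K ] term n v e) ⟩
  ∑[ e ≤ N ] ∑[ v ≤ N ] ∑[ n ≤ K ] term n v e
    ≡⟨ ∑-cong N (λ e _ _ → ∑-cong N (λ v _ _ → ∑-*ʳ K v (λ n → 𝟙 (e * v ≟ f n)))) ⟩
  ∑[ e ≤ N ] cofactorSum N K f e ∎
  where
  open ≡-Reasoning
  term : ℕ → ℕ → ℕ → ℕ
  term n v e = 𝟙 (e * v ≟ f n) * v

module _ (K : ℕ) (f : ℕ → ℕ) where

  hits≤1 : (∀ i j → f i ≡ f j → i ≡ j) → ∀ x → hits K f x ≤ 1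
  hits≤1 f-injective x =
    ∑𝟙-unique (λ n → x ≟ f n) K (λ i j _ _ _ _ x≡fi x≡fj → f-injective i j (trans (sym x≡fi) x≡fj))

  hits-witness : ∀ x → 1 ≤ hits K f x → ∃[ n ] (1 ≤ n × n ≤ K × x ≡ f n)
  hits-witness x = go K
    where
    go : ∀ K → 1 ≤ hits K f x → ∃[ n ] (1 ≤ n × n ≤ K × x ≡ f n)
    go (suc K) 1≤hits with x ≟ f (suc K)
    ... | yes x≡f = suc K , s≤s z≤n , ≤-refl , x≡f
    ... | no  _   with go K (≤-trans 1≤hits (≤-reflexive (+-identityʳ _)))
    ...   | n , 1≤n , n≤K , x≡fn = n , 1≤n , m≤n⇒m≤1+n n≤K , x≡fn

  cofactorSum-lower : ∀ N e s J → 1 ≤ s → s * J ≤ N →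
    (∀ j → 1 ≤ j → j ≤ J → ∃[ n ] (1 ≤ n × n ≤ K × e * (s * j) ≡ f n)) →
    ∑[ j ≤ J ] (s * j) ≤ cofactorSum N K f e
  cofactorSum-lower N e s J 1≤s sJ≤N hit = begin
    ∑[ j ≤ J ] (s * j)                            ≤⟨ ∑-mono-≤ J counted ⟩
    ∑[ j ≤ J ] (hits K f (e * (s * j)) * (s * j)) ≤⟨ ∑-dilate s J (λ v → hits K f (e * v) * v) 1≤s ⟩
    ∑[ v ≤ s * J ] (hits K f (e * v) * v)         ≤⟨ ∑-mono-range (λ v → hits K f (e * v) * v) sJ≤N ⟩
    cofactorSum N K f e                           ∎
    where
    open ≤-Reasoning
    counted : ∀ j → 1 ≤ j → j ≤ J → s * j ≤ hits K f (e * (s * j)) * (s * j)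
    counted j 1≤j j≤J with hit j 1≤j j≤J
    ... | n , 1≤n , n≤K , esj≡fn = ≤-trans (≤-reflexive (sym (*-identityˡ (s * j))))
      (*-monoˡ-≤ (s * j) (∑𝟙-witness (λ n → e * (s * j) ≟ f n) K n 1≤n n≤K esj≡fn))

-- Sums of well-spaced values

module _ (c : ℕ) (w : ℕ → ℕ) (w≤1 : ∀ v → w v ≤ 1)
         (spaced : ∀ u v → 1 ≤ w u → 1 ≤ w v → u < v → u + suc c ≤ v) where

  private
    weighted : ℕ → ℕ
    weighted v = w v * v

    positive : ∀ {v t} → w v ≡ suc t → 1 ≤ w v
    positive eq = subst (1 ≤_) (sym eq) (s≤s z≤n)

  -- A window of at most suc c consecutive numbers meets the support of w at most once.
  ∑-window : ∀ a L → L ≤ suc c → ∑[ i ≤ L ] weighted (a + i) ≤ a + L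
  ∑-window a zero    _     = z≤n
  ∑-window a (suc L) L<1+c with w (a + suc L) in eq
  ... | zero = begin
    ∑[ i ≤ L ] weighted (a + i) + 0 ≡⟨ +-identityʳ _ ⟩
    ∑[ i ≤ L ] weighted (a + i)     ≤⟨ ∑-window a L (<⇒≤ L<1+c) ⟩
    a + L                           ≤⟨ +-monoʳ-≤ a (n≤1+n L) ⟩
    a + suc L                       ∎
    where open ≤-Reasoning
  ... | suc t = begin
    ∑[ i ≤ L ] weighted (a + i) + suc t * (a + suc L) ≡⟨ cong (_+ suc t * (a + suc L)) (∑-vanish L earlier-vanish) ⟩
    suc t * (a + suc L)                               ≤⟨ *-monoˡ-≤ (a + suc L) (subst (_≤ 1) eq (w≤1 _)) ⟩
    1 * (a + suc L)                                   ≡⟨ *-identityˡ _ ⟩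
    a + suc L                                         ∎
    where
    open ≤-Reasoning
    earlier-vanish : ∀ i → 1 ≤ i → i ≤ L → weighted (a + i) ≡ 0
    earlier-vanish i 1≤i i≤L with w (a + i) in eq′
    ... | zero  = refl
    ... | suc _ = ⊥-elim (<-irrefl refl (≤-trans (+-monoˡ-≤ (suc c) 1≤i) (≤-trans i+1+c≤1+L L<1+c)))
      where
      i+1+c≤1+L : i + suc c ≤ suc L
      i+1+c≤1+L = +-cancelˡ-≤ a _ _ (subst (_≤ a + suc L) (+-assoc a i (suc c))
        (spaced (a + i) (a + suc L) (positive eq′) (positive eq) (+-monoʳ-< a (s≤s i≤L))))

  ∑-blocks : ∀ J → ∑[ v ≤ c + suc c * J ] weighted v ≤ ∑[ j ≤ J ] (suc c * j) + c * suc J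
  ∑-blocks zero = begin
    ∑[ v ≤ c + suc c * 0 ] weighted v ≡⟨ cong (λ n → ∑[ v ≤ c + n ] weighted v) (*-zeroʳ (suc c)) ⟩
    ∑[ v ≤ c + 0 ] weighted v         ≡⟨ cong (λ n → ∑[ v ≤ n ] weighted v) (+-identityʳ c) ⟩
    ∑[ v ≤ c ] weighted v             ≤⟨ ∑-window 0 c (n≤1+n c) ⟩
    c                                 ≡⟨ *-identityʳ c ⟨
    c * 1                             ∎
    where open ≤-Reasoning
  ∑-blocks (suc J) = begin
    ∑[ v ≤ c + suc c * suc J ] weighted v
      ≡⟨ cong (λ n → ∑[ v ≤ n ] weighted v) (next-block c J) ⟩
    ∑[ v ≤ c + suc c * J + suc c ] weighted v
      ≡⟨ ∑-+ (c + suc c * J) (suc c) weighted ⟩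
    ∑[ v ≤ c + suc c * J ] weighted v + ∑[ i ≤ suc c ] weighted (c + suc c * J + i)
      ≤⟨ +-mono-≤ (∑-blocks J) (∑-window (c + suc c * J) (suc c) ≤-refl) ⟩
    ∑[ j ≤ J ] (suc c * j) + c * suc J + (c + suc c * J + suc c)
      ≡⟨ next-bound (∑[ j ≤ J ] (suc c * j)) c J ⟩
    ∑[ j ≤ J ] (suc c * j) + suc c * suc J + c * suc (suc J) ∎
    where
    open ≤-Reasoning
    next-block : ∀ c J → c + suc c * suc J ≡ c + suc c * J + suc c
    next-block = solve-∀
    next-bound : ∀ A c J → A + c * suc J + (c + suc c * J + suc c) ≡ A + suc c * suc J + c * suc (suc J)
    next-bound = solve-∀

  ∑-spaced≤ : ∀ J N → (∀ v → 1 ≤ w v → v < suc c * suc J) →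
              ∑[ v ≤ N ] (w v * v) ≤ ∑[ j ≤ J ] (suc c * j) + c * suc J
  ∑-spaced≤ J N support = ≤-trans (∑-support (c + suc c * J) N weighted beyond) (∑-blocks J)
    where
    last-block : ∀ c J → suc c * suc J ≡ suc (c + suc c * J)
    last-block = solve-∀
    beyond : ∀ v → c + suc c * J < v → weighted v ≡ 0
    beyond v v> with w v in eq
    ... | zero  = refl
    ... | suc _ = ⊥-elim (<⇒≱ (subst (v <_) (last-block c J) (support v (positive eq))) v>)

-- Cofactor sums along a residue class

properCofactor : ℕ → ℕ → ℕ
properCofactor m e with 2 ≤? e | e ∣? m
... | yes _ | yes (divides q _) = q
... | _     | _                 = 0

properCofactor-coprime : ∀ m e → gcd e m ≡ 1 → properCofactor m e ≡ 0
properCofactor-coprime m e e⊥m with 2 ≤? e | e ∣? m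
... | yes 2≤e | yes e∣m = ⊥-elim (<⇒≢ 2≤e (sym (∣1⇒≡1 (subst (e ∣_) e⊥m (gcd-greatest ∣-refl e∣m)))))
... | yes _   | no  _   = refl
... | no  _   | yes _   = refl
... | no  _   | no  _   = refl

-- The modulus is suc c, so that the residues are the k ≤ c.
module ResidueClass (c k K : ℕ) where

  bound : ℕ
  bound = suc c * K + c

  shifted : ℕ → ℕ
  shifted n = suc c * n + k

  multiples : ℕ → ℕ
  multiples n = suc c * n

  shifted∈[1,bound] : k ≤ c → ∀ n → 1 ≤ n → n ≤ K → 1 ≤ shifted n × shifted n ≤ bound
  shifted∈[1,bound] k≤c n 1≤n n≤K =
    ≤-trans (*-mono-≤ (s≤s (z≤n {c})) 1≤n) (m≤m+n _ k) , +-mono-≤ (*-monoʳ-≤ (suc c) n≤K) k≤c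

  multiples∈[1,bound] : ∀ n → 1 ≤ n → n ≤ K → 1 ≤ multiples n × multiples n ≤ bound
  multiples∈[1,bound] n 1≤n n≤K = *-mono-≤ (s≤s (z≤n {c})) 1≤n , ≤-trans (*-monoʳ-≤ (suc c) n≤K) (m≤m+n _ c)

  shifted-injective : ∀ i j → shifted i ≡ shifted j → i ≡ j
  shifted-injective i j eq = *-cancelˡ-≡ i j (suc c) (+-cancelʳ-≡ k _ _ eq)

  1+K≤e*[1+K/e] : ∀ e .{{_ : NonZero e}} → suc K ≤ e * suc (K / e)
  1+K≤e*[1+K/e] e = begin
    suc K                   ≡⟨ cong suc (m≡m%n+[m/n]*n K e) ⟩
    suc (K % e + K / e * e) ≤⟨ +-monoˡ-≤ (K / e * e) (m%n<n K e) ⟩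
    e + K / e * e           ≡⟨ *-comm (suc (K / e)) e ⟩
    e * suc (K / e)         ∎
    where open ≤-Reasoning

  shifted-cofactor< : k ≤ c → ∀ e .{{_ : NonZero e}} v n → n ≤ K → e * v ≡ shifted n → v < suc c * suc (K / e)
  shifted-cofactor< k≤c e v n n≤K ev≡ = *-cancelˡ-< e v (suc c * suc (K / e)) (begin-strict
    e * v                     ≡⟨ ev≡ ⟩
    suc c * n + k             ≤⟨ +-mono-≤ (*-monoʳ-≤ (suc c) n≤K) k≤c ⟩
    suc c * K + c             <⟨ n<1+n _ ⟩
    suc (suc c * K + c)       ≡⟨ 1+[m*K+c]≡m*[1+K] c K ⟩
    suc c * suc K             ≤⟨ *-monoʳ-≤ (suc c) (1+K≤e*[1+K/e] e) ⟩
    suc c * (e * suc (K / e)) ≡⟨ x∙yz≈y∙xz (suc c) e (suc (K / e)) ⟩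
    e * (suc c * suc (K / e)) ∎)
    where
    open ≤-Reasoning
    1+[m*K+c]≡m*[1+K] : ∀ c K → suc (suc c * K + c) ≡ suc c * suc K
    1+[m*K+c]≡m*[1+K] = solve-∀

  shifted-cofactors-spaced : ∀ e u v n n′ → gcd e (suc c) ≡ 1 →
    e * u ≡ shifted n → e * v ≡ shifted n′ → u < v → u + suc c ≤ v
  shifted-cofactors-spaced e u v n n′ e⊥m eu≡ ev≡ u<v =
    ≤-trans (+-monoʳ-≤ u (∣⇒≤ {{>-nonZero (m<n⇒0<n∸m u<v)}} m∣v∸u)) (≤-reflexive (m+[n∸m]≡n (<⇒≤ u<v)))
    where
    e*[v∸u]≡m*[n′∸n] : e * (v ∸ u) ≡ suc c * (n′ ∸ n)
    e*[v∸u]≡m*[n′∸n] = begin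
      e * (v ∸ u)                         ≡⟨ *-distribˡ-∸ e v u ⟩
      e * v ∸ e * u                       ≡⟨ cong₂ _∸_ (trans ev≡ (+-comm _ k)) (trans eu≡ (+-comm _ k)) ⟩
      (k + suc c * n′) ∸ (k + suc c * n)  ≡⟨ [m+n]∸[m+o]≡n∸o k _ _ ⟩
      suc c * n′ ∸ suc c * n              ≡⟨ *-distribˡ-∸ (suc c) n′ n ⟨
      suc c * (n′ ∸ n)                    ∎
      where open ≡-Reasoning
    m∣v∸u : suc c ∣ v ∸ u
    m∣v∸u = coprime-divisor {suc c} {e} (Coprimality.sym {e} {suc c} (gcd≡1⇒coprime e⊥m))
              (subst (suc c ∣_) (sym e*[v∸u]≡m*[n′∸n]) (m∣m*n (n′ ∸ n)))

  cofactorSum-shifted-noncoprime : ∀ e → gcd k (suc c) ≡ 1 → ¬ gcd e (suc c) ≡ 1 →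
                                   cofactorSum bound K shifted e ≡ 0
  cofactorSum-shifted-noncoprime e k⊥m e⊥̸m =
    ∑-vanish bound (λ v _ _ → cong (_* v) (∑𝟙-none (λ n → e * v ≟ shifted n) K
      (λ n _ _ ev≡ → e⊥̸m (gcd≡1 v n ev≡))))
    where
    g = gcd e (suc c)
    gcd≡1 : ∀ v n → e * v ≡ shifted n → g ≡ 1
    gcd≡1 v n ev≡ = ∣1⇒≡1 (subst (g ∣_) k⊥m (gcd-greatest g∣k (gcd[m,n]∣n e (suc c))))
      where
      g∣k : g ∣ k
      g∣k = ∣m+n∣m⇒∣n (subst (g ∣_) ev≡ (∣-trans (gcd[m,n]∣m e (suc c)) (m∣m*n v)))
                      (∣-trans (gcd[m,n]∣n e (suc c)) (m∣m*n n))

  cofactorSum-shifted≤ : k ≤ c → ∀ e .{{_ : NonZero e}} → gcd e (suc c) ≡ 1 →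
                         cofactorSum bound K shifted e ≤ ∑[ j ≤ K / e ] (suc c * j) + c * suc (K / e)
  cofactorSum-shifted≤ k≤c e e⊥m =
    ∑-spaced≤ c w (λ v → hits≤1 K shifted shifted-injective (e * v)) spaced (K / e) bound support
    where
    w : ℕ → ℕ
    w v = hits K shifted (e * v)
    spaced : ∀ u v → 1 ≤ w u → 1 ≤ w v → u < v → u + suc c ≤ v
    spaced u v 1≤wu 1≤wv u<v with hits-witness K shifted (e * u) 1≤wu | hits-witness K shifted (e * v) 1≤wv
    ... | n , _ , _ , eu≡ | n′ , _ , _ , ev≡ = shifted-cofactors-spaced e u v n n′ e⊥m eu≡ ev≡ u<v
    support : ∀ v → 1 ≤ w v → v < suc c * suc (K / e)
    support v 1≤wv with hits-witness K shifted (e * v) 1≤wv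
    ... | n , _ , n≤K , ev≡ = shifted-cofactor< k≤c e v n n≤K ev≡

  cofactorSum-multiples≥ : ∀ e .{{_ : NonZero e}} →
                           ∑[ j ≤ K / e ] (suc c * j) ≤ cofactorSum bound K multiples e
  cofactorSum-multiples≥ e =
    cofactorSum-lower K multiples bound e (suc c) (K / e) (s≤s z≤n) m*[K/e]≤bound hit
    where
    m*[K/e]≤bound : suc c * (K / e) ≤ bound
    m*[K/e]≤bound = ≤-trans (*-monoʳ-≤ (suc c) (m/n≤m K e)) (m≤m+n _ c)
    hit : ∀ j → 1 ≤ j → j ≤ K / e → ∃[ n ] (1 ≤ n × n ≤ K × e * (suc c * j) ≡ multiples n)
    hit j 1≤j j≤K/e = e * j , *-mono-≤ (>-nonZero⁻¹ e) 1≤j , e*j≤K , x∙yz≈y∙xz e (suc c) j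
      where
      e*j≤K : e * j ≤ K
      e*j≤K = ≤-trans (≤-reflexive (*-comm e j)) (≤-trans (*-monoˡ-≤ e j≤K/e) (m/n*n≤m K e))

  cofactorSum-multiples-divisor≥ : ∀ e q → suc c ≡ q * e →
                                   q * ∑[ j ≤ K ] j ≤ cofactorSum bound K multiples e
  cofactorSum-multiples-divisor≥ e q m≡qe =
    subst (_≤ cofactorSum bound K multiples e) (∑-*ˡ K q (λ j → j))
      (cofactorSum-lower K multiples bound e q K 1≤q q*K≤bound hit)
    where
    1≤q : 1 ≤ q
    1≤q = n≢0⇒n>0 (λ { refl → 0≢1+n (sym m≡qe) })
    q*K≤bound : q * K ≤ bound
    q*K≤bound = ≤-trans (*-monoˡ-≤ K (∣⇒≤ (divides e (trans m≡qe (*-comm q e))))) (m≤m+n _ c)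
    hit : ∀ j → 1 ≤ j → j ≤ K → ∃[ n ] (1 ≤ n × n ≤ K × e * (q * j) ≡ multiples n)
    hit j 1≤j j≤K = j , 1≤j , j≤K , trans (x∙yz≈yx∙z e q j) (cong (_* j) (sym m≡qe))

  properCofactor*∑≤cofactorSum : ∀ e →
                                 properCofactor (suc c) e * ∑[ j ≤ K ] j ≤ cofactorSum bound K multiples e
  properCofactor*∑≤cofactorSum e with 2 ≤? e | e ∣? suc c
  ... | yes _ | yes (divides q m≡qe) = cofactorSum-multiples-divisor≥ e q m≡qe
  ... | yes _ | no  _                 = z≤n
  ... | no  _ | yes _                 = z≤n
  ... | no  _ | no  _                 = z≤n

  cofactorSum-compare : k ≤ c → gcd k (suc c) ≡ 1 → ∀ e .{{_ : NonZero e}} →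
    cofactorSum bound K shifted e + properCofactor (suc c) e * ∑[ j ≤ K ] j
      ≤ cofactorSum bound K multiples e + 𝟙 (gcd e (suc c) ≟ 1) * (c * suc (K / e))
  cofactorSum-compare k≤c k⊥m e with gcd e (suc c) ≟ 1
  ... | yes e⊥m = begin
    cofactorSum bound K shifted e + properCofactor (suc c) e * ∑[ j ≤ K ] j
      ≡⟨ cong (λ q → cofactorSum bound K shifted e + q * ∑[ j ≤ K ] j) (properCofactor-coprime (suc c) e e⊥m) ⟩
    cofactorSum bound K shifted e + 0
      ≡⟨ +-identityʳ _ ⟩
    cofactorSum bound K shifted e
      ≤⟨ cofactorSum-shifted≤ k≤c e e⊥m ⟩
    ∑[ j ≤ K / e ] (suc c * j) + c * suc (K / e)
      ≤⟨ +-monoˡ-≤ _ (cofactorSum-multiples≥ e) ⟩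
    cofactorSum bound K multiples e + c * suc (K / e)
      ≡⟨ cong (cofactorSum bound K multiples e +_) (+-identityʳ _) ⟨
    cofactorSum bound K multiples e + 1 * (c * suc (K / e)) ∎
    where open ≤-Reasoning
  ... | no e⊥̸m = begin
    cofactorSum bound K shifted e + properCofactor (suc c) e * ∑[ j ≤ K ] j
      ≡⟨ cong (_+ properCofactor (suc c) e * ∑[ j ≤ K ] j) (cofactorSum-shifted-noncoprime e k⊥m e⊥̸m) ⟩
    properCofactor (suc c) e * ∑[ j ≤ K ] j
      ≤⟨ properCofactor*∑≤cofactorSum e ⟩
    cofactorSum bound K multiples e
      ≡⟨ +-identityʳ _ ⟨
    cofactorSum bound K multiples e + 0 ∎
    where open ≤-Reasoning

oddIndicator : ℕ → ℕ
oddIndicator zero          = 0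
oddIndicator (suc zero)    = 1
oddIndicator (suc (suc n)) = oddIndicator n

oddIndicator-pair : ∀ n → oddIndicator n + oddIndicator (suc n) ≡ 1
oddIndicator-pair zero          = refl
oddIndicator-pair (suc zero)    = refl
oddIndicator-pair (suc (suc n)) = oddIndicator-pair n

2*∑oddIndicator≤1+ : ∀ X → 2 * ∑[ e ≤ X ] oddIndicator e ≤ X + 1
2*∑oddIndicator≤1+ zero          = z≤n
2*∑oddIndicator≤1+ (suc zero)    = ≤-refl
2*∑oddIndicator≤1+ (suc (suc X)) = begin
  2 * (∑[ e ≤ X ] oddIndicator e + oddIndicator (suc X) + oddIndicator X)
    ≡⟨ cong (2 *_) (trans (+-assoc S (oddIndicator (suc X)) _) (cong (S +_) (+-comm (oddIndicator (suc X)) _))) ⟩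
  2 * (∑[ e ≤ X ] oddIndicator e + (oddIndicator X + oddIndicator (suc X)))
    ≡⟨ cong (λ o → 2 * (∑[ e ≤ X ] oddIndicator e + o)) (oddIndicator-pair X) ⟩
  2 * (∑[ e ≤ X ] oddIndicator e + 1)
    ≡⟨ *-distribˡ-+ 2 S 1 ⟩
  2 * ∑[ e ≤ X ] oddIndicator e + 2
    ≤⟨ +-monoˡ-≤ 2 (2*∑oddIndicator≤1+ X) ⟩
  X + 1 + 2
    ≡⟨ X+1+2≡2+X+1 X ⟩
  suc (suc X) + 1 ∎
  where
  open ≤-Reasoning
  S = ∑[ e ≤ X ] oddIndicator e
  X+1+2≡2+X+1 : ∀ X → X + 1 + 2 ≡ suc (suc X) + 1
  X+1+2≡2+X+1 = solve-∀

even⇒¬coprime30 : ∀ e → oddIndicator e ≡ 0 → ¬ gcd e 30 ≡ 1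
even⇒¬coprime30 e even e⊥30 = 2≢1 (∣1⇒≡1 (subst (2 ∣_) e⊥30 (gcd-greatest (2∣ e even) (divides 15 refl))))
  where
  2≢1 : 2 ≢ 1
  2≢1 ()
  2∣ : ∀ e → oddIndicator e ≡ 0 → 2 ∣ e
  2∣ zero          _    = divides 0 refl
  2∣ (suc (suc e)) even with 2∣ e even
  ... | divides q e≡2q = divides (suc q) (cong (2 +_) e≡2q)

coprime30⇒odd : ∀ e → gcd e 30 ≡ 1 → oddIndicator e ≡ 1
coprime30⇒odd e e⊥30 with oddIndicator e in eq | oddIndicator-pair e
... | zero      | _ = ⊥-elim (even⇒¬coprime30 e eq e⊥30)
... | suc zero  | _ = refl
... | suc (suc _) | ()

coprime30⇒1⊎7≤ : ∀ e → gcd e 30 ≡ 1 → e ≡ 1 ⊎ 7 ≤ e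
coprime30⇒1⊎7≤ 1 _ = inj₁ refl
coprime30⇒1⊎7≤ (suc (suc (suc (suc (suc (suc (suc e))))))) _ = inj₂ (m≤m+n 7 e)

coprimeWeight : ℕ → ℕ → ℕ
coprimeWeight K e = oddIndicator e + 𝟙 (e ≟ 1) * K + oddIndicator e * 𝟙 (e ≤? K) * (K / 7)

1+K/e≤coprimeWeight : ∀ K e .{{_ : NonZero e}} → gcd e 30 ≡ 1 → suc (K / e) ≤ coprimeWeight K e
1+K/e≤coprimeWeight K e e⊥30 rewrite coprime30⇒odd e e⊥30 with coprime30⇒1⊎7≤ e e⊥30
... | inj₁ refl rewrite n/1≡n K = s≤s (≤-trans (≤-reflexive (sym (+-identityʳ K))) (m≤m+n _ _))
... | inj₂ 7≤e with e ≟ 1 | e ≤? K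
...   | yes refl | _     = ⊥-elim (<⇒≱ 7≤e (s≤s z≤n))
...   | no  _    | yes _ = s≤s (≤-trans (/-monoʳ-≤ K 7≤e) (≤-reflexive (sym (+-identityʳ (K / 7)))))
...   | no  _    | no e≰K rewrite m<n⇒m/n≡0 {K} {e} (≰⇒> e≰K) = s≤s z≤n

∑coprimeWeight≤ : ∀ K N → K ≤ N →
  ∑[ e ≤ N ] coprimeWeight K e ≤ ∑[ e ≤ N ] oddIndicator e + K + ∑[ e ≤ K ] oddIndicator e * (K / 7)
∑coprimeWeight≤ K N K≤N = begin
  ∑[ e ≤ N ] coprimeWeight K e
    ≡⟨ ∑-distrib-+ N (λ e → oddIndicator e + 𝟙 (e ≟ 1) * K) (λ e → oddIndicator e * 𝟙 (e ≤? K) * (K / 7)) ⟩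
  ∑[ e ≤ N ] (oddIndicator e + 𝟙 (e ≟ 1) * K) + ∑[ e ≤ N ] (oddIndicator e * 𝟙 (e ≤? K) * (K / 7))
    ≡⟨ cong₂ _+_ (trans (∑-distrib-+ N oddIndicator (λ e → 𝟙 (e ≟ 1) * K))
                        (cong (∑[ e ≤ N ] oddIndicator e +_) (∑-*ʳ N K (λ e → 𝟙 (e ≟ 1)))))
                 (∑-*ʳ N (K / 7) (λ e → oddIndicator e * 𝟙 (e ≤? K))) ⟩
  ∑[ e ≤ N ] oddIndicator e + ∑[ e ≤ N ] 𝟙 (e ≟ 1) * K + ∑[ e ≤ N ] (oddIndicator e * 𝟙 (e ≤? K)) * (K / 7)
    ≤⟨ +-mono-≤ (+-monoʳ-≤ (∑[ e ≤ N ] oddIndicator e) (*-monoˡ-≤ K one))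
                (*-monoˡ-≤ (K / 7) odd-up-to-K) ⟩
  ∑[ e ≤ N ] oddIndicator e + 1 * K + ∑[ e ≤ K ] oddIndicator e * (K / 7)
    ≡⟨ cong (λ x → ∑[ e ≤ N ] oddIndicator e + x + ∑[ e ≤ K ] oddIndicator e * (K / 7)) (*-identityˡ K) ⟩
  ∑[ e ≤ N ] oddIndicator e + K + ∑[ e ≤ K ] oddIndicator e * (K / 7) ∎
  where
  open ≤-Reasoning
  one : ∑[ e ≤ N ] 𝟙 (e ≟ 1) ≤ 1
  one = ∑𝟙-unique (_≟ 1) N (λ i j _ _ _ _ i≡1 j≡1 → trans i≡1 (sym j≡1))
  oddIndicator*𝟙≤ : ∀ e → oddIndicator e * 𝟙 (e ≤? K) ≤ oddIndicator e
  oddIndicator*𝟙≤ e = ≤-trans (*-monoʳ-≤ (oddIndicator e) (𝟙≤1 (e ≤? K))) (≤-reflexive (*-identityʳ _))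
  beyond-K : ∀ e → K < e → oddIndicator e * 𝟙 (e ≤? K) ≡ 0
  beyond-K e K<e with e ≤? K
  ... | yes e≤K = ⊥-elim (<⇒≱ K<e e≤K)
  ... | no  _   = *-zeroʳ (oddIndicator e)
  odd-up-to-K : ∑[ e ≤ N ] (oddIndicator e * 𝟙 (e ≤? K)) ≤ ∑[ e ≤ K ] oddIndicator e
  odd-up-to-K = ≤-trans (∑-support K N _ beyond-K) (∑-mono-≤ K (λ e _ _ → oddIndicator*𝟙≤ e))

quadratic< : ∀ K → 25 ≤ K → 29 * (7 * (30 * K + 29 + 1) + 14 * K + (K + 1) * K) < 294 * (K * suc K)
quadratic< K 25≤K = begin-strict
  29 * (7 * (30 * K + 29 + 1) + 14 * K + (K + 1) * K) ≤⟨ *-monoʳ-≤ 29 (+-monoˡ-≤ ((K + 1) * K) linear) ⟩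
  29 * (224 * suc K + (K + 1) * K)                     ≡⟨ factor K ⟩
  29 * (224 + K) * suc K                               <⟨ *-monoˡ-< (suc K) 29[224+K]<294K ⟩
  294 * K * suc K                                      ≡⟨ *-assoc 294 K (suc K) ⟩
  294 * (K * suc K)                                    ∎
  where
  open ≤-Reasoning
  linear : 7 * (30 * K + 29 + 1) + 14 * K ≤ 224 * suc K
  linear = ≤-trans (m≤m+n _ 14) (≤-reflexive (expand K))
    where
    expand : ∀ K → 7 * (30 * K + 29 + 1) + 14 * K + 14 ≡ 224 * suc K
    expand = solve-∀
  factor : ∀ K → 29 * (224 * suc K + (K + 1) * K) ≡ 29 * (224 + K) * suc K
  factor = solve-∀
  29[224+K]<294K : 29 * (224 + K) < 294 * K
  29[224+K]<294K = begin-strict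
    29 * (224 + K)  ≡⟨ *-distribˡ-+ 29 224 K ⟩
    6496 + 29 * K   <⟨ +-monoˡ-< (29 * K) (≤ᵇ⇒≤ 6497 6625 _) ⟩
    265 * 25 + 29 * K ≤⟨ +-monoˡ-≤ (29 * K) (*-monoʳ-≤ 265 25≤K) ⟩
    265 * K + 29 * K ≡⟨ *-distribʳ-+ K 265 29 ⟨
    294 * K         ∎

-- Multiplying by 14 clears the factors 2 and 7 of the hypotheses.
29*weights<42*triangle : ∀ K O₁ O₂ q Δ W → 25 ≤ K →
  W ≤ O₁ + K + O₂ * q → 2 * O₁ ≤ 30 * K + 29 + 1 → 2 * O₂ ≤ K + 1 → q * 7 ≤ K → 2 * Δ ≡ K * suc K →
  29 * W < 42 * Δ
29*weights<42*triangle K O₁ O₂ q Δ W 25≤K W≤ O₁≤ O₂≤ q≤ 2Δ≡ = *-cancelˡ-< 14 (29 * W) (42 * Δ) (begin-strict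
  14 * (29 * W)                                        ≤⟨ *-monoʳ-≤ 14 (*-monoʳ-≤ 29 W≤) ⟩
  14 * (29 * (O₁ + K + O₂ * q))                        ≡⟨ regroup O₁ K O₂ q ⟩
  29 * (7 * (2 * O₁) + 14 * K + 2 * O₂ * (q * 7))      ≤⟨ *-monoʳ-≤ 29 (+-mono-≤ (+-monoˡ-≤ (14 * K) (*-monoʳ-≤ 7 O₁≤)) (*-mono-≤ O₂≤ q≤)) ⟩
  29 * (7 * (30 * K + 29 + 1) + 14 * K + (K + 1) * K)  <⟨ quadratic< K 25≤K ⟩
  294 * (K * suc K)                                    ≡⟨ cong (294 *_) 2Δ≡ ⟨
  294 * (2 * Δ)                                        ≡⟨ regroup′ Δ ⟩
  14 * (42 * Δ)                                        ∎)
  where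
  open ≤-Reasoning
  regroup : ∀ O₁ K O₂ q → 14 * (29 * (O₁ + K + O₂ * q)) ≡ 29 * (7 * (2 * O₁) + 14 * K + 2 * O₂ * (q * 7))
  regroup = solve-∀
  regroup′ : ∀ Δ → 294 * (2 * Δ) ≡ 14 * (42 * Δ)
  regroup′ = solve-∀

-- 42 = σ 30 - 30.
∑properCofactor30 : ∑[ e ≤ 30 ] properCofactor 30 e ≡ 42
∑properCofactor30 = refl

module _ (k K : ℕ) (k≤29 : k ≤ 29) (k⊥30 : gcd k 30 ≡ 1) (25≤K : 25 ≤ K) where
  open ResidueClass 29 k K

  private
    Δ = ∑[ j ≤ K ] j
    W = ∑[ e ≤ bound ] coprimeWeight K e

    cofactorSum-compare30 : ∀ e → 1 ≤ e →
      cofactorSum bound K shifted e + properCofactor 30 e * Δ ≤ cofactorSum bound K multiples e + 29 * coprimeWeight K e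
    cofactorSum-compare30 e 1≤e = ≤-trans (cofactorSum-compare k≤29 k⊥30 e {{>-nonZero 1≤e}})
      (+-monoʳ-≤ _ (weight e {{>-nonZero 1≤e}}))
      where
      weight : ∀ e .{{_ : NonZero e}} → 𝟙 (gcd e 30 ≟ 1) * (29 * suc (K / e)) ≤ 29 * coprimeWeight K e
      weight e with gcd e 30 ≟ 1
      ... | yes e⊥30 = ≤-trans (≤-reflexive (+-identityʳ _)) (*-monoʳ-≤ 29 (1+K/e≤coprimeWeight K e e⊥30))
      ... | no  _    = z≤n

    ∑σ-shifted+42Δ≤ : ∑[ n ≤ K ] σ (30 * n + k) + 42 * Δ ≤ ∑[ n ≤ K ] σ (30 * n) + 29 * W
    ∑σ-shifted+42Δ≤ = begin
      ∑[ n ≤ K ] σ (30 * n + k) + 42 * Δ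
        ≡⟨ cong₂ _+_ (∑σ≡∑cofactorSum K bound shifted (shifted∈[1,bound] k≤29)) (cong (_* Δ) (sym ∑properCofactor30)) ⟩
      ∑[ e ≤ bound ] cofactorSum bound K shifted e + ∑[ e ≤ 30 ] properCofactor 30 e * Δ
        ≤⟨ +-monoʳ-≤ _ (*-monoˡ-≤ Δ (∑-mono-range (properCofactor 30) 30≤bound)) ⟩
      ∑[ e ≤ bound ] cofactorSum bound K shifted e + ∑[ e ≤ bound ] properCofactor 30 e * Δ
        ≡⟨ cong (∑[ e ≤ bound ] cofactorSum bound K shifted e +_) (∑-*ʳ bound Δ (properCofactor 30)) ⟨
      ∑[ e ≤ bound ] cofactorSum bound K shifted e + ∑[ e ≤ bound ] (properCofactor 30 e * Δ)
        ≡⟨ ∑-distrib-+ bound _ _ ⟨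
      ∑[ e ≤ bound ] (cofactorSum bound K shifted e + properCofactor 30 e * Δ)
        ≤⟨ ∑-mono-≤ bound (λ e 1≤e _ → cofactorSum-compare30 e 1≤e) ⟩
      ∑[ e ≤ bound ] (cofactorSum bound K multiples e + 29 * coprimeWeight K e)
        ≡⟨ ∑-distrib-+ bound _ _ ⟩
      ∑[ e ≤ bound ] cofactorSum bound K multiples e + ∑[ e ≤ bound ] (29 * coprimeWeight K e)
        ≡⟨ cong₂ _+_ (∑σ≡∑cofactorSum K bound multiples multiples∈[1,bound]) (sym (∑-*ˡ bound 29 (coprimeWeight K))) ⟨
      ∑[ n ≤ K ] σ (30 * n) + 29 * W ∎
      where
      open ≤-Reasoning
      30≤bound : 30 ≤ bound
      30≤bound = ≤-trans (m≤m*n 30 K {{>-nonZero (≤-trans (s≤s z≤n) 25≤K)}}) (m≤m+n _ 29)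

    29W<42Δ : 29 * W < 42 * Δ
    29W<42Δ = 29*weights<42*triangle K (∑[ e ≤ bound ] oddIndicator e) (∑[ e ≤ K ] oddIndicator e) (K / 7) Δ W 25≤K
      (∑coprimeWeight≤ K bound K≤bound) (2*∑oddIndicator≤1+ bound) (2*∑oddIndicator≤1+ K) (m/n*n≤m K 7) (2*∑id≡K*[1+K] K)
      where
      K≤bound : K ≤ bound
      K≤bound = ≤-trans (m≤n*m K 30) (m≤m+n _ 29)

  ∑σ-shifted<∑σ-multiples : ∑[ n ≤ K ] σ (30 * n + k) < ∑[ n ≤ K ] σ (30 * n)
  ∑σ-shifted<∑σ-multiples = +-cancelʳ-< (42 * Δ) _ _ (≤-<-trans ∑σ-shifted+42Δ≤ (+-monoʳ-< (∑[ n ≤ K ] σ (30 * n)) 29W<42Δ))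

-- Small K

-- Checks the claim for K = i + 1, …, i + fuel, given the two sums up to i in a and b;
-- carrying the running sums along keeps the computation linear in fuel.
dominates : (k i fuel a b : ℕ) → Bool
dominates k i zero       a b = true
dominates k i (suc fuel) a b = next (a + σ (30 * suc i + k)) (b + σ (30 * suc i))
  where
  next : ℕ → ℕ → Bool
  next a′ b′ = (a′ <ᵇ b′) ∧ dominates k (suc i) fuel a′ b′

dominates-sound : ∀ k fuel i →
  T (dominates k i fuel (∑[ n ≤ i ] σ (30 * n + k)) (∑[ n ≤ i ] σ (30 * n))) →
  ∀ K → i < K → K ≤ fuel + i → ∑[ n ≤ K ] σ (30 * n + k) < ∑[ n ≤ K ] σ (30 * n)
dominates-sound k zero       i _  K i<K K≤i = ⊥-elim (<⇒≱ i<K K≤i)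
dominates-sound k (suc fuel) i ok K i<K K≤ with m≤n⇒m<n∨m≡n i<K
... | inj₂ refl = <ᵇ⇒< _ _ (proj₁ (Equivalence.to T-∧ ok))
... | inj₁ 1+i<K = dominates-sound k fuel (suc i) (proj₂ (Equivalence.to T-∧ ok)) K 1+i<K
                    (subst (K ≤_) (sym (+-suc fuel i)) K≤)

residues-checked : All (λ k → gcd k 30 ≡ 1 → T (dominates k 0 24 0 0)) (upTo 30)
residues-checked = toWitness {a? = All.all? (λ k → (gcd k 30 ≟ 1) →-dec T? (dominates k 0 24 0 0)) (upTo 30)} _

∑σ-shifted<∑σ-multiples-small : ∀ k K → k ≤ 29 → gcd k 30 ≡ 1 → 1 ≤ K → K ≤ 24 →
  ∑[ n ≤ K ] σ (30 * n + k) < ∑[ n ≤ K ] σ (30 * n)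
∑σ-shifted<∑σ-multiples-small k K k≤29 k⊥30 1≤K K≤24 =
  dominates-sound k 24 0 (All.lookup residues-checked (∈-upTo⁺ (s≤s k≤29)) k⊥30)
    K 1≤K (subst (K ≤_) (sym (+-identityʳ 24)) K≤24)

theorem1p1 : ∀ (k : ℕ) → 1 ≤ k → k ≤ 29 → gcd k 30 ≡ 1 →
    ∀ (K : ℕ) → 1 ≤ K →
    sumFrom1 K (λ n → σ (30 * n + k)) < sumFrom1 K (λ n → σ (30 * n))
theorem1p1 k _ k≤29 k⊥30 K 1≤K with 25 ≤? K
... | yes 25≤K = ∑σ-shifted<∑σ-multiples k K k≤29 k⊥30 25≤K
... | no  K≱25 = ∑σ-shifted<∑σ-multiples-small k K k≤29 k⊥30 1≤K (≤-pred (≰⇒> K≱25))
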